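{- For integers $b\geqslant -1$ and $a\geqslant b-1$, \[F(a,b)=\sum_{i=0}^{b}\sum_{j=i}^{a+2b-2i}q^{j}t^{(a+2b-i)-j}.\]
   Context: Let $q,t$ be indeterminates. A standard Young tableau $T$ with $n$ boxes is a bijective filling of the Young diagram of a partition of $n$ by $1,\dots,n$, increasing along rows (left to right) and columns (bottom to top); rows $r$ counted from the bottom, columns $c$ from the left, starting at $1$. Let $z_i=q^{c-1}t^{r-1}$ where $i$ sits in row $r$, column $c$. Define \[\mathrm{wt}(T)=\prod_{i=2}^{n}\frac{1}{(1-z_i^{ -1})(1-qtz_{i-1}/z_i)}\prod_{1\leqslant i<j\leqslant n}\frac{(1-z_i/z_j)(1-qtz_i/z_j)}{(1-qz_i/z_j)(1-tz_i/z_j)},\] omitting any individual factor that vanishes, and $F(a_2,\dots,a_n)=\sum_T z_2^{a_2}\cdots z_n^{a_n}\mathrm{wt}(T)$ over all standard Young tableaux with $n$ boxes; $F(a,b)$ is the case $n=3$. Empty sums are $0$. -}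

module Defs where

open import Data.Nat as ℕ using (ℕ; zero; suc)
open import Data.Integer as ℤ using (ℤ; +_; -[1+_])
open import Data.Rational as ℚ using (ℚ; 0ℚ; 1ℚ; 1/_)
import Data.Rational.Properties as ℚP
open import Data.Product using (_×_; _,_; proj₁; proj₂)
open import Data.List using (List; []; _∷_; _++_; [_]; map; concatMap; foldr; length)
open import Data.Bool using (Bool; true; false; if_then_else_; _∧_)
open import Relation.Nullary using (yes; no)
open import Relation.Nullary.Decidable using (⌊_⌋)
open import Relation.Binary.PropositionalEquality using (_≡_; _≢_)

-- total inverse: inv 0 = 0 (only ever used at nonzero arguments under
-- the genericity hypothesis of the statement)
inv : ℚ → ℚ
inv x with x ℚP.≟ 0ℚ
... | yes _ = 0ℚ
... | no x≢0 = 1/_ x {{ℚ.≢-nonZero x≢0}}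

powℕ : ℚ → ℕ → ℚ
powℕ x zero = 1ℚ
powℕ x (suc n) = x ℚ.* powℕ x n

pow : ℚ → ℤ → ℚ
pow x (+ n) = powℕ x n
pow x -[1+ n ] = inv (powℕ x (suc n))

sumℚ : List ℚ → ℚ
sumℚ = foldr ℚ._+_ 0ℚ

prodℚ : List ℚ → ℚ
prodℚ = foldr ℚ._*_ 1ℚ

-- Laurent monomials q^α t^β, represented by their exponent pair (α , β)

Mono : Set
Mono = ℤ × ℤ

_·ₘ_ : Mono → Mono → Mono
(a , b) ·ₘ (c , d) = (a ℤ.+ c , b ℤ.+ d)

_/ₘ_ : Mono → Mono → Mono
(a , b) /ₘ (c , d) = (a ℤ.- c , b ℤ.- d)

_^ₘ_ : Mono → ℤ → Mono
(a , b) ^ₘ k = (k ℤ.* a , k ℤ.* b)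

oneₘ qₘ tₘ qtₘ : Mono
oneₘ = (+ 0 , + 0)
qₘ = (+ 1 , + 0)
tₘ = (+ 0 , + 1)
qtₘ = (+ 1 , + 1)

evalₘ : ℚ → ℚ → Mono → ℚ
evalₘ q t (α , β) = pow q α ℚ.* pow t β

isOneₘ : Mono → Bool
isOneₘ (α , β) = ⌊ α ℤ.≟ + 0 ⌋ ∧ ⌊ β ℤ.≟ + 0 ⌋

-- the factor (1 - m), evaluated at (q , t); a factor that vanishes
-- identically (i.e. m = 1 as a monomial) is omitted, i.e. replaced by 1
fac : ℚ → ℚ → Mono → ℚ
fac q t m = if isOneₘ m then 1ℚ else (1ℚ ℚ.- evalₘ q t m)

-- a cell (r , c): row r (from the bottom), column c (from the left), 1-based
Cell : Set
Cell = ℕ × ℕ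

-- a standard Young tableau with n boxes is recorded as the list of cells
-- containing 1, 2, …, n (in this order); the tableaux with n+1 boxes are
-- obtained from those with n boxes by placing n+1 in an addable (outer)
-- corner of the shape, which enumerates each SYT exactly once.

rowLen : List Cell → ℕ → ℕ
rowLen [] r = 0
rowLen ((r' , c) ∷ T) r = if ⌊ r ℕ.≟ r' ⌋ then suc (rowLen T r) else rowLen T r

-- addable cells of the shape of T: (r , λ_r + 1) for r = 1, …, ℓ+1
-- such that r = 1 or λ_{r-1} > λ_r
addable : List Cell → List Cell
addable T = go (suc (length T)) 1
  where
  go : ℕ → ℕ → List Cell
  go zero r = []
  go (suc k) r with r
  ... | zero = go k 1
  ... | suc zero = (1 , suc (rowLen T 1)) ∷ go k 2
  ... | suc (suc r') =
    if ⌊ rowLen T (suc (suc r')) ℕ.<? rowLen T (suc r') ⌋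
    then (suc (suc r') , suc (rowLen T (suc (suc r')))) ∷ go k (suc (suc (suc r')))
    else go k (suc (suc (suc r')))

SYT : ℕ → List (List Cell)
SYT zero = [ [] ]
SYT (suc n) = concatMap (λ T → map (λ c → T ++ [ c ]) (addable T)) (SYT n)

zₘ : Cell → Mono
zₘ (r , c) = (+ (c ℕ.∸ 1) , + (r ℕ.∸ 1))

consecPart : ℚ → ℚ → List Mono → ℚ
consecPart q t [] = 1ℚ
consecPart q t (z₁ ∷ []) = 1ℚ
consecPart q t (z₁ ∷ z₂ ∷ zs) =
  inv (fac q t (oneₘ /ₘ z₂) ℚ.* fac q t ((qtₘ ·ₘ z₁) /ₘ z₂))
  ℚ.* consecPart q t (z₂ ∷ zs)

pairFac : ℚ → ℚ → Mono → Mono → ℚ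
pairFac q t zi zj =
  (fac q t (zi /ₘ zj) ℚ.* fac q t ((qtₘ ·ₘ zi) /ₘ zj))
  ℚ.* inv (fac q t ((qₘ ·ₘ zi) /ₘ zj) ℚ.* fac q t ((tₘ ·ₘ zi) /ₘ zj))

pairPart : ℚ → ℚ → List Mono → ℚ
pairPart q t [] = 1ℚ
pairPart q t (zi ∷ zs) = prodℚ (map (pairFac q t zi) zs) ℚ.* pairPart q t zs

wt : ℚ → ℚ → List Cell → ℚ
wt q t T = consecPart q t (map zₘ T) ℚ.* pairPart q t (map zₘ T)

F3 : ℚ → ℚ → ℤ → ℤ → ℚ
F3 q t a b = sumℚ (map term (SYT 3))
  where
  term : List Cell → ℚ
  term (c₁ ∷ c₂ ∷ c₃ ∷ []) =
    evalₘ q t (zₘ c₂ ^ₘ a) ℚ.* evalₘ q t (zₘ c₃ ^ₘ b) ℚ.* wt q t (c₁ ∷ c₂ ∷ c₃ ∷ [])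
  term _ = 0ℚ   -- never occurs: every element of SYT 3 has 3 cells

rangeCount : ℤ → ℤ → ℕ
rangeCount lo hi with hi ℤ.- lo ℤ.+ + 1
... | + n = n
... | -[1+ _ ] = 0

sumFromTo : ℤ → ℤ → (ℤ → ℚ) → ℚ
sumFromTo lo hi f = go (rangeCount lo hi) 0
  where
  go : ℕ → ℕ → ℚ
  go zero k = 0ℚ
  go (suc m) k = f (lo ℤ.+ + k) ℚ.+ go m (suc k)

-- q and t are "generic": nonzero and no nontrivial Laurent monomial
-- q^α t^β equals 1 (e.g. q = 2, t = 3)
Generic : ℚ → ℚ → Set
Generic q t = (q ≢ 0ℚ) × (t ≢ 0ℚ) ×
  ((α β : ℤ) → isOneₘ (α , β) ≡ false → evalₘ q t (α , β) ≢ 1ℚ)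

{-# OPTIONS --safe #-}
module Submission where

-- Every standard Young tableau T with three boxes has wt(T) = P_T / D with D = (q − t)(q² − t)(t² − q)
-- and P_T equal to ±(q − t²) or ±(t − q²) times a monomial; the weights are computed exactly by evaluating
-- them symbolically as quotients of polynomials in q and t and normalising with the ring solver.
-- So F(a, b) · D is a signed sum of four monomials. On the other side the inner sum is geometric,
--   (q − t) Σ_j q^j t^(a+2b−i−j) = q^(a+2b−2i+1) t^i − q^i t^(a+2b−2i+1),
-- and both terms are again geometric in i, so that
--   G(i) = (q − t²) q^(a+2b−2i+3) t^i − (t − q²) q^i t^(a+2b−2i+3)
-- satisfies G(i + 1) − G(i) = D · (inner sum at i). The outer sum telescopes to G(b + 1) − G(0), whose
-- four monomials are exactly those contributed by the four tableaux. The hypotheses on a and b make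
-- every range of summation non-empty (the inner range at i ≤ b has a − b + 1 + 3(b − i) terms), as
-- telescoping needs; genericity of (q, t) makes D and all factors of the weights invertible.

open import Defs

open import Algebra.Bundles using (AbelianGroup; CommutativeMonoid)
import Algebra.Properties.CommutativeSemigroup as CommutativeSemigroupProperties
import Algebra.Properties.Group as GroupProperties
open import Data.Bool using (true; false; if_then_else_)
open import Data.Empty using (⊥-elim)
import Data.Fin as Fin
open import Data.Integer as ℤ using (ℤ; +_; -[1+_]; ∣_∣)
import Data.Integer.Properties as ℤ
import Data.Integer.Tactic.RingSolver as ℤ-Solver
open import Data.List using (List; []; _∷_; map)
open import Data.Nat using (ℕ; zero; suc)
open import Data.Product using (_,_; proj₁; proj₂)
import Data.Rational
open import Data.Rational as ℚ using (ℚ; 0ℚ; 1ℚ)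
import Data.Rational.Properties as ℚ
open import Data.Rational.Solver using (module +-*-Solver)
open import Data.Vec using (Vec) renaming ([] to []ᵥ; _∷_ to _∷ᵥ_)
open import Level using (0ℓ)
open import Relation.Binary.PropositionalEquality
open import Relation.Nullary using (yes; no)
open import Relation.Nullary.Decidable using (dec⇒maybe)
open import Tactic.RingSolver using (solve-∀)
open import Tactic.RingSolver.Core.AlmostCommutativeRing using (AlmostCommutativeRing; fromCommutativeRing)

open +-*-Solver using (Polynomial; ⟦_⟧; ⟦_⟧↓; var; con; _:*_; _:-_; :-_; prove)

private
  module ℚ+ = GroupProperties (AbelianGroup.group ℚ.+-0-abelianGroup)
  module ℚ* = CommutativeSemigroupProperties (CommutativeMonoid.commutativeSemigroup ℚ.*-1-commutativeMonoid)
  module ℤ+ = GroupProperties (AbelianGroup.group ℤ.+-0-abelianGroup)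

ℚ-ring : AlmostCommutativeRing 0ℓ 0ℓ
ℚ-ring = fromCommutativeRing ℚ.+-*-commutativeRing (λ x → dec⇒maybe (0ℚ ℚ.≟ x))

module _ where
  open Data.Rational using (_*_)
  open ≡-Reasoning

  inv-inverseʳ : ∀ {x} → x ≢ 0ℚ → x * inv x ≡ 1ℚ
  inv-inverseʳ {x} x≢0 with x ℚ.≟ 0ℚ
  ... | yes x≡0  = ⊥-elim (x≢0 x≡0)
  ... | no  x≢0′ = ℚ.*-inverseʳ x {{ℚ.≢-nonZero x≢0′}}

  inv-inverseˡ : ∀ {x} → x ≢ 0ℚ → inv x * x ≡ 1ℚ
  inv-inverseˡ {x} x≢0 = trans (ℚ.*-comm (inv x) x) (inv-inverseʳ x≢0)

  *-cancelʳ-≢0 : ∀ {x y d} → d ≢ 0ℚ → x * d ≡ y * d → x ≡ y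
  *-cancelʳ-≢0 {x} {y} {d} d≢0 xd≡yd = begin
    x                ≡⟨ sym (ℚ.*-identityʳ x) ⟩
    x * 1ℚ           ≡⟨ cong (x *_) (sym (inv-inverseʳ d≢0)) ⟩
    x * (d * inv d)  ≡⟨ sym (ℚ.*-assoc x d (inv d)) ⟩
    x * d * inv d    ≡⟨ cong (_* inv d) xd≡yd ⟩
    y * d * inv d    ≡⟨ ℚ.*-assoc y d (inv d) ⟩
    y * (d * inv d)  ≡⟨ cong (y *_) (inv-inverseʳ d≢0) ⟩
    y * 1ℚ           ≡⟨ ℚ.*-identityʳ y ⟩
    y                ∎

  *-≢0 : ∀ {x y} → x ≢ 0ℚ → y ≢ 0ℚ → x * y ≢ 0ℚ
  *-≢0 {x} {y} x≢0 y≢0 xy≡0 = x≢0 (*-cancelʳ-≢0 y≢0 (trans xy≡0 (sym (ℚ.*-zeroˡ y))))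

  inv-*-cancelʳ : ∀ {x y} → x ≢ 0ℚ → y ≢ 0ℚ → inv (x * y) * x ≡ inv y
  inv-*-cancelʳ {x} {y} x≢0 y≢0 = *-cancelʳ-≢0 y≢0 (begin
    inv (x * y) * x * y    ≡⟨ ℚ.*-assoc (inv (x * y)) x y ⟩
    inv (x * y) * (x * y)  ≡⟨ inv-inverseˡ (*-≢0 x≢0 y≢0) ⟩
    1ℚ                     ≡⟨ sym (inv-inverseˡ y≢0) ⟩
    inv y * y              ∎)

module _ {x : ℚ} (x≢0 : x ≢ 0ℚ) where
  open Data.Rational using (_*_)
  open ≡-Reasoning

  powℕ-≢0 : ∀ n → powℕ x n ≢ 0ℚ
  powℕ-≢0 zero    = ℚ.1≢0
  powℕ-≢0 (suc n) = *-≢0 x≢0 (powℕ-≢0 n)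

  pow-suc : ∀ k → pow x (k ℤ.+ + 1) ≡ pow x k * x
  pow-suc (+ zero)       = trans (ℚ.*-identityʳ x) (sym (ℚ.*-identityˡ x))
  pow-suc (+ suc n)      = trans (cong (x *_) (pow-suc (+ n))) (sym (ℚ.*-assoc x (powℕ x n) x))
  pow-suc -[1+ zero ]    = sym (inv-*-cancelʳ x≢0 ℚ.1≢0)
  pow-suc -[1+ suc n ]   = sym (inv-*-cancelʳ x≢0 (powℕ-≢0 (suc n)))

  pow-+ℕ : ∀ k n → pow x (k ℤ.+ + n) ≡ pow x k * powℕ x n
  pow-+ℕ k zero    = trans (cong (pow x) (ℤ.+-identityʳ k)) (sym (ℚ.*-identityʳ (pow x k)))
  pow-+ℕ k (suc n) = begin
    pow x (k ℤ.+ + suc n)          ≡⟨ cong (pow x) (sym (ℤ.+-assoc k (+ 1) (+ n))) ⟩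
    pow x (k ℤ.+ + 1 ℤ.+ + n)      ≡⟨ pow-+ℕ (k ℤ.+ + 1) n ⟩
    pow x (k ℤ.+ + 1) * powℕ x n   ≡⟨ cong (_* powℕ x n) (pow-suc k) ⟩
    pow x k * x * powℕ x n         ≡⟨ ℚ.*-assoc (pow x k) x (powℕ x n) ⟩
    pow x k * (x * powℕ x n)       ∎

  pow-+ : ∀ i j → pow x (i ℤ.+ j) ≡ pow x i * pow x j
  pow-+ i (+ n)    = pow-+ℕ i n
  pow-+ i -[1+ n ] = *-cancelʳ-≢0 P≢0 (begin
    pow x (i ℤ.+ -[1+ n ]) * P           ≡⟨ sym (pow-+ℕ (i ℤ.+ -[1+ n ]) (suc n)) ⟩
    pow x (i ℤ.+ -[1+ n ] ℤ.+ + suc n)   ≡⟨ cong (pow x) (ℤ.+-assoc i -[1+ n ] (+ suc n)) ⟩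
    pow x (i ℤ.+ (-[1+ n ] ℤ.+ + suc n)) ≡⟨ cong (λ k → pow x (i ℤ.+ k)) (ℤ.+-inverseˡ (+ suc n)) ⟩
    pow x (i ℤ.+ + 0)                    ≡⟨ cong (pow x) (ℤ.+-identityʳ i) ⟩
    pow x i                              ≡⟨ sym (ℚ.*-identityʳ (pow x i)) ⟩
    pow x i * 1ℚ                         ≡⟨ cong (pow x i *_) (sym (inv-inverseˡ P≢0)) ⟩
    pow x i * (inv P * P)                ≡⟨ sym (ℚ.*-assoc (pow x i) (inv P) P) ⟩
    pow x i * inv P * P                  ∎)
    where
    P = powℕ x (suc n)
    P≢0 = powℕ-≢0 (suc n)

private
  -- sumFromTo is computed by a helper local to its definition, which cannot be named here;
  -- the meta partialSum is solved to that helper by the clause below, exposing its equations.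
  mutual
    partialSum : ℤ → ℤ → (ℤ → ℚ) → ℕ → ℕ → ℚ
    partialSum = _

    sumFromTo-partialSum : ∀ lo hi f → sumFromTo lo hi f ≡ partialSum lo hi f (rangeCount lo hi) 0
    sumFromTo-partialSum lo hi f with rangeCount lo hi | 0
    ... | n | k = refl

rangeCount-≡ : ∀ lo hi {n} → hi ℤ.- lo ℤ.+ + 1 ≡ + n → rangeCount lo hi ≡ n
rangeCount-≡ lo hi eq rewrite eq = refl

+-suc : ∀ i n → i ℤ.+ + suc n ≡ i ℤ.+ + n ℤ.+ + 1
+-suc i n = trans (cong (λ k → i ℤ.+ k) (ℤ.+-comm (+ 1) (+ n))) (sym (ℤ.+-assoc i (+ n) (+ 1)))

module _ where
  open Data.Rational using (_+_; _-_; _*_)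
  open ≡-Reasoning

  partialSum-telescope : ∀ lo hi (f g : ℤ → ℚ) (s : ℚ) →
    (∀ j → lo ℤ.≤ j → j ℤ.≤ hi → g (j ℤ.+ + 1) - g j ≡ s * f j) →
    ∀ m k → lo ℤ.+ + k ℤ.+ + m ≡ hi ℤ.+ + 1 →
    s * partialSum lo hi f m k ≡ g (hi ℤ.+ + 1) - g (lo ℤ.+ + k)
  partialSum-telescope lo hi f g s step zero k eq = begin
    s * 0ℚ                           ≡⟨ ℚ.*-zeroʳ s ⟩
    0ℚ                               ≡⟨ ℚ.+-inverseʳ (g (lo ℤ.+ + k)) ⟨
    g (lo ℤ.+ + k) - g (lo ℤ.+ + k)  ≡⟨ cong (λ i → g i - g (lo ℤ.+ + k)) (trans (sym (ℤ.+-identityʳ _)) eq) ⟩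
    g (hi ℤ.+ + 1) - g (lo ℤ.+ + k)  ∎
  partialSum-telescope lo hi f g s step (suc m) k eq = begin
    s * (f j + partialSum lo hi f m (suc k))
      ≡⟨ ℚ.*-distribˡ-+ s (f j) _ ⟩
    s * f j + s * partialSum lo hi f m (suc k)
      ≡⟨ cong₂ _+_ (sym (step j (ℤ.i≤i+j lo (+ k)) j≤hi))
                   (partialSum-telescope lo hi f g s step m (suc k) eq′) ⟩
    (g (j ℤ.+ + 1) - g j) + (g (hi ℤ.+ + 1) - g (lo ℤ.+ + suc k))
      ≡⟨ cong (λ i → (g i - g j) + (g (hi ℤ.+ + 1) - g (lo ℤ.+ + suc k))) (+-suc lo k) ⟨
    (g (lo ℤ.+ + suc k) - g j) + (g (hi ℤ.+ + 1) - g (lo ℤ.+ + suc k))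
      ≡⟨ [y-x]+[z-y]≡z-x (g j) (g (lo ℤ.+ + suc k)) (g (hi ℤ.+ + 1)) ⟩
    g (hi ℤ.+ + 1) - g j
      ∎
    where
    j = lo ℤ.+ + k
    j≤hi : j ℤ.≤ hi
    j≤hi = subst (j ℤ.≤_) (ℤ+.∙-cancelʳ (+ 1) _ _ (trans (sym (+-suc j m)) eq)) (ℤ.i≤i+j j (+ m))
    eq′ : lo ℤ.+ + suc k ℤ.+ + m ≡ hi ℤ.+ + 1
    eq′ = begin
      lo ℤ.+ + suc k ℤ.+ + m      ≡⟨ cong (ℤ._+ + m) (+-suc lo k) ⟩
      lo ℤ.+ + k ℤ.+ + 1 ℤ.+ + m  ≡⟨ ℤ.+-assoc j (+ 1) (+ m) ⟩
      j ℤ.+ + suc m               ≡⟨ eq ⟩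
      hi ℤ.+ + 1                  ∎
    [y-x]+[z-y]≡z-x : ∀ x y z → (y - x) + (z - y) ≡ z - x
    [y-x]+[z-y]≡z-x = solve-∀ ℚ-ring

  sumFromTo-telescope : ∀ lo hi (f g : ℤ → ℚ) (s : ℚ) → lo ℤ.≤ hi ℤ.+ + 1 →
    (∀ j → lo ℤ.≤ j → j ℤ.≤ hi → g (j ℤ.+ + 1) - g j ≡ s * f j) →
    s * sumFromTo lo hi f ≡ g (hi ℤ.+ + 1) - g lo
  sumFromTo-telescope lo hi f g s lo≤hi+1 step = begin
    s * sumFromTo lo hi f
      ≡⟨ cong (s *_) (sumFromTo-partialSum lo hi f) ⟩
    s * partialSum lo hi f (rangeCount lo hi) 0
      ≡⟨ cong (λ n → s * partialSum lo hi f n 0) (rangeCount-≡ lo hi count) ⟩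
    s * partialSum lo hi f N 0
      ≡⟨ partialSum-telescope lo hi f g s step N 0 (trans (cong (ℤ._+ + N) (ℤ.+-identityʳ lo)) top) ⟩
    g (hi ℤ.+ + 1) - g (lo ℤ.+ + 0)
      ≡⟨ cong (λ j → g (hi ℤ.+ + 1) - g j) (ℤ.+-identityʳ lo) ⟩
    g (hi ℤ.+ + 1) - g lo
      ∎
    where
    N : ℕ
    N = ∣ hi ℤ.+ + 1 ℤ.- lo ∣
    N-def : + N ≡ hi ℤ.+ + 1 ℤ.- lo
    N-def = ℤ.0≤i⇒+∣i∣≡i (ℤ.i≤j⇒0≤j-i lo≤hi+1)
    count : hi ℤ.- lo ℤ.+ + 1 ≡ + N
    count = begin
      hi ℤ.- lo ℤ.+ + 1  ≡⟨ ℤ-Solver.solve (hi ∷ lo ∷ []) ⟩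
      hi ℤ.+ + 1 ℤ.- lo  ≡⟨ N-def ⟨
      + N                ∎
    top : lo ℤ.+ + N ≡ hi ℤ.+ + 1
    top = begin
      lo ℤ.+ + N                  ≡⟨ cong (λ n → lo ℤ.+ n) N-def ⟩
      lo ℤ.+ (hi ℤ.+ + 1 ℤ.- lo)  ≡⟨ ℤ-Solver.solve (hi ∷ lo ∷ []) ⟩
      hi ℤ.+ + 1                  ∎

-- Symbolic counterparts of the definitions behind wt, computing a weight as a quotient of polynomials
-- in q and t, so that identities between weights become polynomial identities the ring solver decides.

Poly : Set
Poly = Polynomial 2

𝕢 𝕥 : Poly
𝕢 = var Fin.zero
𝕥 = var (Fin.suc Fin.zero)

record Frac : Set where
  constructor _/_
  field
    num den : Poly

infixl 7 _·F_
infix  8 _⁻¹F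

1F : Frac
1F = con 1ℚ / con 1ℚ

_·F_ : Frac → Frac → Frac
(n / d) ·F (n′ / d′) = (n :* n′) / (d :* d′)

_⁻¹F : Frac → Frac
(n / d) ⁻¹F = d / n

1-F : Frac → Frac
1-F (n / d) = (d :- n) / d

powP : Poly → ℕ → Poly
powP v zero    = con 1ℚ
powP v (suc n) = v :* powP v n

powF : Poly → ℤ → Frac
powF v (+ n)    = powP v n / con 1ℚ
powF v -[1+ n ] = con 1ℚ / powP v (suc n)

monoF : Mono → Frac
monoF (α , β) = powF 𝕢 α ·F powF 𝕥 β

facF : Mono → Frac
facF m = if isOneₘ m then 1F else 1-F (monoF m)

consecF : List Mono → Frac
consecF []             = 1F
consecF (z₁ ∷ [])      = 1F
consecF (z₁ ∷ z₂ ∷ zs) =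
  (facF (oneₘ /ₘ z₂) ·F facF ((qtₘ ·ₘ z₁) /ₘ z₂)) ⁻¹F ·F consecF (z₂ ∷ zs)

pairFacF : Mono → Mono → Frac
pairFacF zi zj =
  (facF (zi /ₘ zj) ·F facF ((qtₘ ·ₘ zi) /ₘ zj))
  ·F (facF ((qₘ ·ₘ zi) /ₘ zj) ·F facF ((tₘ ·ₘ zi) /ₘ zj)) ⁻¹F

prodF : List Frac → Frac
prodF []       = 1F
prodF (r ∷ rs) = r ·F prodF rs

pairPartF : List Mono → Frac
pairPartF []        = 1F
pairPartF (zi ∷ zs) = prodF (map (pairFacF zi) zs) ·F pairPartF zs

wtF : List Cell → Frac
wtF T = consecF (map zₘ T) ·F pairPartF (map zₘ T)

module _ (q t : ℚ) where
  open Data.Rational using (_-_; _*_)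
  open ≡-Reasoning

  ρ : Vec ℚ 2
  ρ = q ∷ᵥ t ∷ᵥ []ᵥ

  record Represents (x : ℚ) (r : Frac) : Set where
    field
      cleared : x * ⟦ Frac.den r ⟧ ρ ≡ ⟦ Frac.num r ⟧ ρ
      den≢0   : ⟦ Frac.den r ⟧ ρ ≢ 0ℚ
  open Represents

  num≢0 : ∀ {x n d} → x ≢ 0ℚ → Represents x (n / d) → ⟦ n ⟧ ρ ≢ 0ℚ
  num≢0 x≢0 x≅n/d n≡0 = *-≢0 x≢0 (den≢0 x≅n/d) (trans (cleared x≅n/d) n≡0)

  clear-denominator : ∀ {x n d} → Represents x (n / d) → ∀ D p →
    ⟦ n :* D ⟧↓ ρ ≡ ⟦ p :* d ⟧↓ ρ → x * ⟦ D ⟧ ρ ≡ ⟦ p ⟧ ρ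
  clear-denominator {x} {n} {d} x≅n/d D p nD≡pd = *-cancelʳ-≢0 (den≢0 x≅n/d) (begin
    x * ⟦ D ⟧ ρ * ⟦ d ⟧ ρ  ≡⟨ ℚ*.xy∙z≈xz∙y x (⟦ D ⟧ ρ) (⟦ d ⟧ ρ) ⟩
    x * ⟦ d ⟧ ρ * ⟦ D ⟧ ρ  ≡⟨ cong (_* ⟦ D ⟧ ρ) (cleared x≅n/d) ⟩
    ⟦ n ⟧ ρ * ⟦ D ⟧ ρ      ≡⟨ prove ρ (n :* D) (p :* d) nD≡pd ⟩
    ⟦ p ⟧ ρ * ⟦ d ⟧ ρ      ∎)

  1-rep : Represents 1ℚ 1F
  1-rep = record { cleared = refl ; den≢0 = ℚ.1≢0 }

  ·-rep : ∀ {x y r s} → Represents x r → Represents y s → Represents (x * y) (r ·F s)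
  ·-rep {x} {y} {n / d} {n′ / d′} x≅r y≅s = record
    { cleared = trans (ℚ*.interchange x y (⟦ d ⟧ ρ) (⟦ d′ ⟧ ρ))
                      (cong₂ _*_ (cleared x≅r) (cleared y≅s))
    ; den≢0   = *-≢0 (den≢0 x≅r) (den≢0 y≅s)
    }

  inv-rep : ∀ {x r} → x ≢ 0ℚ → Represents x r → Represents (inv x) (r ⁻¹F)
  inv-rep {x} {n / d} x≢0 x≅r = record
    { cleared = begin
        inv x * ⟦ n ⟧ ρ        ≡⟨ cong (inv x *_) (sym (cleared x≅r)) ⟩
        inv x * (x * ⟦ d ⟧ ρ)  ≡⟨ sym (ℚ.*-assoc (inv x) x _) ⟩
        inv x * x * ⟦ d ⟧ ρ    ≡⟨ cong (_* ⟦ d ⟧ ρ) (inv-inverseˡ x≢0) ⟩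
        1ℚ * ⟦ d ⟧ ρ           ≡⟨ ℚ.*-identityˡ _ ⟩
        ⟦ d ⟧ ρ                ∎
    ; den≢0   = num≢0 x≢0 x≅r
    }

  1-F-rep : ∀ {x r} → Represents x r → Represents (1ℚ - x) (1-F r)
  1-F-rep {x} {n / d} x≅r = record
    { cleared = trans ([1-x]*y≡y-x*y x (⟦ d ⟧ ρ)) (cong (λ y → ⟦ d ⟧ ρ - y) (cleared x≅r))
    ; den≢0   = den≢0 x≅r
    }
    where
    [1-x]*y≡y-x*y : ∀ x y → (1ℚ - x) * y ≡ y - x * y
    [1-x]*y≡y-x*y = solve-∀ ℚ-ring

  ⟦powP⟧ : ∀ v n → ⟦ powP v n ⟧ ρ ≡ powℕ (⟦ v ⟧ ρ) n
  ⟦powP⟧ v zero    = refl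
  ⟦powP⟧ v (suc n) = cong (⟦ v ⟧ ρ *_) (⟦powP⟧ v n)

  pow-rep : ∀ v → ⟦ v ⟧ ρ ≢ 0ℚ → ∀ k → Represents (pow (⟦ v ⟧ ρ) k) (powF v k)
  pow-rep v v≢0 (+ n) = record
    { cleared = trans (ℚ.*-identityʳ _) (sym (⟦powP⟧ v n))
    ; den≢0   = ℚ.1≢0
    }
  pow-rep v v≢0 -[1+ n ] = record
    { cleared = trans (cong (inv P *_) (⟦powP⟧ v (suc n))) (inv-inverseˡ P≢0)
    ; den≢0   = λ P′≡0 → P≢0 (trans (sym (⟦powP⟧ v (suc n))) P′≡0)
    }
    where
    P = powℕ (⟦ v ⟧ ρ) (suc n)
    P≢0 = powℕ-≢0 v≢0 (suc n)

  evalₘ-rep : q ≢ 0ℚ → t ≢ 0ℚ → ∀ m → Represents (evalₘ q t m) (monoF m)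
  evalₘ-rep q≢0 t≢0 (α , β) = ·-rep (pow-rep 𝕢 q≢0 α) (pow-rep 𝕥 t≢0 β)

  fac-rep : q ≢ 0ℚ → t ≢ 0ℚ → ∀ m → Represents (fac q t m) (facF m)
  fac-rep q≢0 t≢0 m with isOneₘ m
  ... | true  = 1-rep
  ... | false = 1-F-rep (evalₘ-rep q≢0 t≢0 m)

  module _ (gen : Generic q t) where

    private
      q≢0 = proj₁ gen
      t≢0 = proj₁ (proj₂ gen)

    fac-≢0 : ∀ m → fac q t m ≢ 0ℚ
    fac-≢0 m with isOneₘ m in m≢1
    ... | true  = ℚ.1≢0
    ... | false = λ 1-m≡0 →
      proj₂ (proj₂ gen) (proj₁ m) (proj₂ m) m≢1
        (sym (ℚ+.x∙y⁻¹≈ε⇒x≈y 1ℚ (evalₘ q t m) 1-m≡0))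

    inv-fac²-rep : ∀ m m′ → Represents (inv (fac q t m * fac q t m′)) ((facF m ·F facF m′) ⁻¹F)
    inv-fac²-rep m m′ =
      inv-rep (*-≢0 (fac-≢0 m) (fac-≢0 m′)) (·-rep (fac-rep q≢0 t≢0 m) (fac-rep q≢0 t≢0 m′))

    consecPart-rep : ∀ zs → Represents (consecPart q t zs) (consecF zs)
    consecPart-rep []             = 1-rep
    consecPart-rep (z₁ ∷ [])      = 1-rep
    consecPart-rep (z₁ ∷ z₂ ∷ zs) =
      ·-rep (inv-fac²-rep (oneₘ /ₘ z₂) ((qtₘ ·ₘ z₁) /ₘ z₂)) (consecPart-rep (z₂ ∷ zs))

    pairFac-rep : ∀ zi zj → Represents (pairFac q t zi zj) (pairFacF zi zj)
    pairFac-rep zi zj =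
      ·-rep (·-rep (fac-rep q≢0 t≢0 (zi /ₘ zj)) (fac-rep q≢0 t≢0 ((qtₘ ·ₘ zi) /ₘ zj)))
            (inv-fac²-rep ((qₘ ·ₘ zi) /ₘ zj) ((tₘ ·ₘ zi) /ₘ zj))

    pairPart-rep : ∀ zs → Represents (pairPart q t zs) (pairPartF zs)
    pairPart-rep []        = 1-rep
    pairPart-rep (zi ∷ zs) = ·-rep (row zs) (pairPart-rep zs)
      where
      row : ∀ zs → Represents (prodℚ (map (pairFac q t zi) zs)) (prodF (map (pairFacF zi) zs))
      row []        = 1-rep
      row (zj ∷ zs) = ·-rep (pairFac-rep zi zj) (row zs)

    wt-rep : ∀ T → Represents (wt q t T) (wtF T)
    wt-rep T = ·-rep (consecPart-rep (map zₘ T)) (pairPart-rep (map zₘ T))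

-- The tableaux of SYT 3, in the order listed there, so that F3 q t a b unfolds to a sum over them.
T₁ T₂ T₃ T₄ : List Cell
T₁ = (1 , 1) ∷ (1 , 2) ∷ (1 , 3) ∷ []
T₂ = (1 , 1) ∷ (1 , 2) ∷ (2 , 1) ∷ []
T₃ = (1 , 1) ∷ (2 , 1) ∷ (1 , 2) ∷ []
T₄ = (1 , 1) ∷ (2 , 1) ∷ (3 , 1) ∷ []

module _ where
  open Data.Rational using (_-_; _*_)

  wtDenominator : ℚ → ℚ → ℚ
  wtDenominator q t = (q - t) * ((q * q - t) * (t * t - q))

module _ {q t : ℚ} (gen : Generic q t) where
  open Data.Rational using (_-_; _*_; -_)

  private
    𝔻 : Poly
    𝔻 = (𝕢 :- 𝕥) :* ((𝕢 :* 𝕢 :- 𝕥) :* (𝕥 :* 𝕥 :- 𝕢))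

    monoP : ℕ → ℕ → Poly
    monoP α β = Frac.num (monoF (+ α , + β))

    wt-cleared : ∀ T p →
      ⟦ Frac.num (wtF T) :* 𝔻 ⟧↓ (ρ q t) ≡ ⟦ p :* Frac.den (wtF T) ⟧↓ (ρ q t) →
      wt q t T * wtDenominator q t ≡ ⟦ p ⟧ (ρ q t)
    wt-cleared T = clear-denominator q t (wt-rep q t gen T) 𝔻

  wt-T₁ : wt q t T₁ * wtDenominator q t ≡ - (q - t * t) * evalₘ q t (+ 3 , + 0)
  wt-T₁ = wt-cleared T₁ (:- (𝕢 :- 𝕥 :* 𝕥) :* monoP 3 0) refl

  wt-T₂ : wt q t T₂ * wtDenominator q t ≡ (q - t * t) * evalₘ q t (+ 1 , + 1)
  wt-T₂ = wt-cleared T₂ ((𝕢 :- 𝕥 :* 𝕥) :* monoP 1 1) refl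

  wt-T₃ : wt q t T₃ * wtDenominator q t ≡ - (t - q * q) * evalₘ q t (+ 1 , + 1)
  wt-T₃ = wt-cleared T₃ (:- (𝕥 :- 𝕢 :* 𝕢) :* monoP 1 1) refl

  wt-T₄ : wt q t T₄ * wtDenominator q t ≡ (t - q * q) * evalₘ q t (+ 0 , + 3)
  wt-T₄ = wt-cleared T₄ ((𝕥 :- 𝕢 :* 𝕢) :* monoP 0 3) refl

  -- q − t, q² − t and t² − q are the numerators of the factors 1 − t/q, 1 − t/q² and 1 − q/t².
  wtDenominator-≢0 : wtDenominator q t ≢ 0ℚ
  wtDenominator-≢0 =
    *-≢0 (numerator-≢0 (-[1+ 0 ] , + 1) (𝕢 :- 𝕥) refl)
         (*-≢0 (numerator-≢0 (-[1+ 1 ] , + 1) (𝕢 :* 𝕢 :- 𝕥) refl)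
               (numerator-≢0 (+ 1 , -[1+ 1 ]) (𝕥 :* 𝕥 :- 𝕢) refl))
    where
    numerator-≢0 : ∀ m p → ⟦ Frac.num (facF m) ⟧↓ (ρ q t) ≡ ⟦ p ⟧↓ (ρ q t) →
      ⟦ p ⟧ (ρ q t) ≢ 0ℚ
    numerator-≢0 m p eq =
      subst (_≢ 0ℚ) (prove (ρ q t) (Frac.num (facF m)) p eq)
            (num≢0 q t (fac-≢0 q t gen m) (fac-rep q t (proj₁ gen) (proj₁ (proj₂ gen)) m))

inner-nonempty : ∀ {a b i} → b ℤ.- + 1 ℤ.≤ a → i ℤ.≤ b →
  i ℤ.≤ a ℤ.+ + 2 ℤ.* b ℤ.- + 2 ℤ.* i ℤ.+ + 1
inner-nonempty {a} {b} {i} b-1≤a i≤b = begin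
  i
    ≡⟨ ℤ.+-identityʳ i ⟨
  i ℤ.+ + 0
    ≤⟨ ℤ.+-monoʳ-≤ i (ℤ.+-mono-≤ (ℤ.i≤j⇒0≤j-i b-1≤a) (ℤ.*-monoˡ-≤-nonNeg (+ 3) (ℤ.i≤j⇒0≤j-i i≤b))) ⟩
  i ℤ.+ ((a ℤ.- (b ℤ.- + 1)) ℤ.+ + 3 ℤ.* (b ℤ.- i))
    ≡⟨ ℤ-Solver.solve (a ∷ b ∷ i ∷ []) ⟩
  a ℤ.+ + 2 ℤ.* b ℤ.- + 2 ℤ.* i ℤ.+ + 1
    ∎
  where open ℤ.≤-Reasoning

module _ {q t : ℚ} (q≢0 : q ≢ 0ℚ) (t≢0 : t ≢ 0ℚ) where
  open Data.Rational using (_+_; _-_; _*_; -_)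
  open ≡-Reasoning

  evalₘ-+ : ∀ α β γ δ → evalₘ q t (α ℤ.+ γ , β ℤ.+ δ) ≡ evalₘ q t (α , β) * evalₘ q t (γ , δ)
  evalₘ-+ α β γ δ = trans (cong₂ _*_ (pow-+ q≢0 α γ) (pow-+ t≢0 β δ))
                          (ℚ*.interchange (pow q α) (pow q γ) (pow t β) (pow t δ))

  evalₘ-sucˡ : ∀ α β → evalₘ q t (α ℤ.+ + 1 , β) ≡ evalₘ q t (α , β) * q
  evalₘ-sucˡ α β = trans (cong (_* pow t β) (pow-suc q≢0 α)) (ℚ*.xy∙z≈xz∙y (pow q α) q (pow t β))

  evalₘ-sucʳ : ∀ α β → evalₘ q t (α , β ℤ.+ + 1) ≡ evalₘ q t (α , β) * t
  evalₘ-sucʳ α β = trans (cong (pow q α *_) (pow-suc t≢0 β)) (sym (ℚ.*-assoc (pow q α) (pow t β) t))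

  evalₘ-·³ : ∀ m₁ m₂ m₃ {m} → (m₁ ·ₘ m₂) ·ₘ m₃ ≡ m →
    evalₘ q t m₁ * evalₘ q t m₂ * evalₘ q t m₃ ≡ evalₘ q t m
  evalₘ-·³ (α₁ , β₁) (α₂ , β₂) (α₃ , β₃) refl = begin
    evalₘ q t (α₁ , β₁) * evalₘ q t (α₂ , β₂) * evalₘ q t (α₃ , β₃)
      ≡⟨ cong (_* evalₘ q t (α₃ , β₃)) (sym (evalₘ-+ α₁ β₁ α₂ β₂)) ⟩
    evalₘ q t (α₁ ℤ.+ α₂ , β₁ ℤ.+ β₂) * evalₘ q t (α₃ , β₃)
      ≡⟨ sym (evalₘ-+ (α₁ ℤ.+ α₂) (β₁ ℤ.+ β₂) α₃ β₃) ⟩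
    evalₘ q t (α₁ ℤ.+ α₂ ℤ.+ α₃ , β₁ ℤ.+ β₂ ℤ.+ β₃)
      ∎

  geometric-sum : ∀ lo hi M → lo ℤ.≤ hi ℤ.+ + 1 →
    (q - t) * sumFromTo lo hi (λ j → evalₘ q t (j , M ℤ.- j)) ≡
    evalₘ q t (hi ℤ.+ + 1 , M ℤ.- hi) - evalₘ q t (lo , M ℤ.- lo ℤ.+ + 1)
  geometric-sum lo hi M lo≤hi+1 = begin
    (q - t) * sumFromTo lo hi f
      ≡⟨ sumFromTo-telescope lo hi f g (q - t) lo≤hi+1 (λ j _ _ → step j) ⟩
    g (hi ℤ.+ + 1) - g lo
      ≡⟨ cong (λ β → evalₘ q t (hi ℤ.+ + 1 , β) - g lo) (exponent hi) ⟩
    evalₘ q t (hi ℤ.+ + 1 , M ℤ.- hi) - g lo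
      ∎
    where
    f g : ℤ → ℚ
    f j = evalₘ q t (j , M ℤ.- j)
    g j = evalₘ q t (j , M ℤ.- j ℤ.+ + 1)
    exponent : ∀ j → M ℤ.- (j ℤ.+ + 1) ℤ.+ + 1 ≡ M ℤ.- j
    exponent j = ℤ-Solver.solve (M ∷ j ∷ [])
    x*y-x*z≡[y-z]*x : ∀ x y z → x * y - x * z ≡ (y - z) * x
    x*y-x*z≡[y-z]*x = solve-∀ ℚ-ring
    step : ∀ j → g (j ℤ.+ + 1) - g j ≡ (q - t) * f j
    step j = begin
      g (j ℤ.+ + 1) - g j
        ≡⟨ cong (λ β → evalₘ q t (j ℤ.+ + 1 , β) - g j) (exponent j) ⟩
      evalₘ q t (j ℤ.+ + 1 , M ℤ.- j) - g j
        ≡⟨ cong₂ _-_ (evalₘ-sucˡ j (M ℤ.- j)) (evalₘ-sucʳ j (M ℤ.- j)) ⟩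
      f j * q - f j * t
        ≡⟨ x*y-x*z≡[y-z]*x (f j) q t ⟩
      (q - t) * f j
        ∎

  module _ (s : ℤ) where

    innerSum : ℤ → ℚ
    innerSum i = sumFromTo i (s ℤ.- + 2 ℤ.* i) (λ j → evalₘ q t (j , (s ℤ.- i) ℤ.- j))

    innerSum-closed : ∀ i → i ℤ.≤ s ℤ.- + 2 ℤ.* i ℤ.+ + 1 →
      (q - t) * innerSum i ≡ evalₘ q t (s ℤ.- + 2 ℤ.* i ℤ.+ + 1 , i) - evalₘ q t (i , s ℤ.- + 2 ℤ.* i ℤ.+ + 1)
    innerSum-closed i i≤ = begin
      (q - t) * innerSum i
        ≡⟨ geometric-sum i (s ℤ.- + 2 ℤ.* i) (s ℤ.- i) i≤ ⟩
      evalₘ q t (s ℤ.- + 2 ℤ.* i ℤ.+ + 1 , s ℤ.- i ℤ.- (s ℤ.- + 2 ℤ.* i)) - evalₘ q t (i , s ℤ.- i ℤ.- i ℤ.+ + 1)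
        ≡⟨ cong₂ (λ β α → evalₘ q t (s ℤ.- + 2 ℤ.* i ℤ.+ + 1 , β) - evalₘ q t (i , α)) top bottom ⟩
      evalₘ q t (s ℤ.- + 2 ℤ.* i ℤ.+ + 1 , i) - evalₘ q t (i , s ℤ.- + 2 ℤ.* i ℤ.+ + 1)
        ∎
      where
      top : s ℤ.- i ℤ.- (s ℤ.- + 2 ℤ.* i) ≡ i
      top = ℤ-Solver.solve (s ∷ i ∷ [])
      bottom : s ℤ.- i ℤ.- i ℤ.+ + 1 ≡ s ℤ.- + 2 ℤ.* i ℤ.+ + 1
      bottom = ℤ-Solver.solve (s ∷ i ∷ [])

    -- The two terms of innerSum-closed are geometric in i, with ratios t/q² and q/t²; the
    -- coefficients q − t² and t − q² make both telescope against this one function.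
    potential : ℤ → ℚ
    potential i = (q - t * t) * evalₘ q t (s ℤ.- + 2 ℤ.* i ℤ.+ + 3 , i)
                - (t - q * q) * evalₘ q t (i , s ℤ.- + 2 ℤ.* i ℤ.+ + 3)

    potential-step : ∀ i → i ℤ.≤ s ℤ.- + 2 ℤ.* i ℤ.+ + 1 →
      potential (i ℤ.+ + 1) - potential i ≡ wtDenominator q t * innerSum i
    potential-step i i≤ = begin
      potential (i ℤ.+ + 1) - potential i
        ≡⟨ cong₂ _-_ (cong₂ (λ u v → (q - t * t) * u - (t - q * q) * v) next₁ next₂)
                     (cong₂ (λ u v → (q - t * t) * u - (t - q * q) * v) this₁ this₂) ⟩
      ((q - t * t) * (x₁ * t) - (t - q * q) * (x₂ * q)) - ((q - t * t) * (x₁ * q * q) - (t - q * q) * (x₂ * t * t))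
        ≡⟨ factorise q t x₁ x₂ ⟩
      (q * q - t) * (t * t - q) * (x₁ - x₂)
        ≡⟨ cong (λ x → (q * q - t) * (t * t - q) * x) (innerSum-closed i i≤) ⟨
      (q * q - t) * (t * t - q) * ((q - t) * innerSum i)
        ≡⟨ reassociate q t (innerSum i) ⟩
      wtDenominator q t * innerSum i
        ∎
      where
      c : ℤ
      c = s ℤ.- + 2 ℤ.* i ℤ.+ + 1
      x₁ x₂ : ℚ
      x₁ = evalₘ q t (c , i)
      x₂ = evalₘ q t (i , c)
      shifted : s ℤ.- + 2 ℤ.* (i ℤ.+ + 1) ℤ.+ + 3 ≡ s ℤ.- + 2 ℤ.* i ℤ.+ + 1
      shifted = ℤ-Solver.solve (s ∷ i ∷ [])
      unshifted : s ℤ.- + 2 ℤ.* i ℤ.+ + 3 ≡ s ℤ.- + 2 ℤ.* i ℤ.+ + 1 ℤ.+ + 1 ℤ.+ + 1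
      unshifted = ℤ-Solver.solve (s ∷ i ∷ [])
      next₁ : evalₘ q t (s ℤ.- + 2 ℤ.* (i ℤ.+ + 1) ℤ.+ + 3 , i ℤ.+ + 1) ≡ x₁ * t
      next₁ = trans (cong (λ α → evalₘ q t (α , i ℤ.+ + 1)) shifted) (evalₘ-sucʳ c i)
      next₂ : evalₘ q t (i ℤ.+ + 1 , s ℤ.- + 2 ℤ.* (i ℤ.+ + 1) ℤ.+ + 3) ≡ x₂ * q
      next₂ = trans (cong (λ β → evalₘ q t (i ℤ.+ + 1 , β)) shifted) (evalₘ-sucˡ i c)
      this₁ : evalₘ q t (s ℤ.- + 2 ℤ.* i ℤ.+ + 3 , i) ≡ x₁ * q * q
      this₁ = begin
        evalₘ q t (s ℤ.- + 2 ℤ.* i ℤ.+ + 3 , i)  ≡⟨ cong (λ α → evalₘ q t (α , i)) unshifted ⟩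
        evalₘ q t (c ℤ.+ + 1 ℤ.+ + 1 , i)        ≡⟨ evalₘ-sucˡ (c ℤ.+ + 1) i ⟩
        evalₘ q t (c ℤ.+ + 1 , i) * q            ≡⟨ cong (_* q) (evalₘ-sucˡ c i) ⟩
        x₁ * q * q                               ∎
      this₂ : evalₘ q t (i , s ℤ.- + 2 ℤ.* i ℤ.+ + 3) ≡ x₂ * t * t
      this₂ = begin
        evalₘ q t (i , s ℤ.- + 2 ℤ.* i ℤ.+ + 3)  ≡⟨ cong (λ β → evalₘ q t (i , β)) unshifted ⟩
        evalₘ q t (i , c ℤ.+ + 1 ℤ.+ + 1)        ≡⟨ evalₘ-sucʳ i (c ℤ.+ + 1) ⟩
        evalₘ q t (i , c ℤ.+ + 1) * t            ≡⟨ cong (_* t) (evalₘ-sucʳ i c) ⟩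
        x₂ * t * t                               ∎
      factorise : ∀ q t x₁ x₂ →
        ((q - t * t) * (x₁ * t) - (t - q * q) * (x₂ * q)) - ((q - t * t) * (x₁ * q * q) - (t - q * q) * (x₂ * t * t))
        ≡ (q * q - t) * (t * t - q) * (x₁ - x₂)
      factorise = solve-∀ ℚ-ring
      reassociate : ∀ q t x →
        (q * q - t) * (t * t - q) * ((q - t) * x) ≡ (q - t) * ((q * q - t) * (t * t - q)) * x
      reassociate = solve-∀ ℚ-ring

  module _ (a b : ℤ) where

    sum-cleared : -[1+ 0 ] ℤ.≤ b → b ℤ.- + 1 ℤ.≤ a →
      wtDenominator q t * sumFromTo (+ 0) b (innerSum (a ℤ.+ + 2 ℤ.* b)) ≡
      potential (a ℤ.+ + 2 ℤ.* b) (b ℤ.+ + 1) - potential (a ℤ.+ + 2 ℤ.* b) (+ 0)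
    sum-cleared -1≤b b-1≤a =
      sumFromTo-telescope (+ 0) b (innerSum (a ℤ.+ + 2 ℤ.* b)) (potential (a ℤ.+ + 2 ℤ.* b))
        (wtDenominator q t) (ℤ.+-monoˡ-≤ (+ 1) -1≤b)
        (λ i _ i≤b → potential-step (a ℤ.+ + 2 ℤ.* b) i (inner-nonempty b-1≤a i≤b))

    F3-cleared : Generic q t →
      F3 q t a b * wtDenominator q t ≡
      potential (a ℤ.+ + 2 ℤ.* b) (b ℤ.+ + 1) - potential (a ℤ.+ + 2 ℤ.* b) (+ 0)
    F3-cleared gen = begin
      F3 q t a b * wtDenominator q t
        ≡⟨ distribute c₁ c₂ c₃ c₄ (wt q t T₁) (wt q t T₂) (wt q t T₃) (wt q t T₄) (wtDenominator q t) ⟩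
      c₁ * (wt q t T₁ * wtDenominator q t) + (c₂ * (wt q t T₂ * wtDenominator q t) +
        (c₃ * (wt q t T₃ * wtDenominator q t) + c₄ * (wt q t T₄ * wtDenominator q t)))
        ≡⟨ cong₂ _+_ (cong (c₁ *_) (wt-T₁ gen)) (cong₂ _+_ (cong (c₂ *_) (wt-T₂ gen))
             (cong₂ _+_ (cong (c₃ *_) (wt-T₃ gen)) (cong (c₄ *_) (wt-T₄ gen)))) ⟩
      c₁ * (- (q - t * t) * e₁) + (c₂ * ((q - t * t) * e₂) + (c₃ * (- (t - q * q) * e₂) + c₄ * ((t - q * q) * e₄)))
        ≡⟨ regroup q t c₁ c₂ c₃ c₄ e₁ e₂ e₄ ⟩
      ((q - t * t) * (c₂ * e₂) - (t - q * q) * (c₃ * e₂)) - ((q - t * t) * (c₁ * e₁) - (t - q * q) * (c₄ * e₄))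
        ≡⟨ cong₂ _-_ (cong₂ (λ u v → (q - t * t) * u - (t - q * q) * v)
                       (evalₘ-·³ (qₘ ^ₘ a) (tₘ ^ₘ b) (+ 1 , + 1) (cong₂ _,_ end b+1))
                       (evalₘ-·³ (tₘ ^ₘ a) (qₘ ^ₘ b) (+ 1 , + 1) (cong₂ _,_ b+1 end)))
                     (cong₂ (λ u v → (q - t * t) * u - (t - q * q) * v)
                       (evalₘ-·³ (qₘ ^ₘ a) ((+ 2 , + 0) ^ₘ b) (+ 3 , + 0) (cong₂ _,_ start origin))
                       (evalₘ-·³ (tₘ ^ₘ a) ((+ 0 , + 2) ^ₘ b) (+ 0 , + 3) (cong₂ _,_ origin start))) ⟩
      potential (a ℤ.+ + 2 ℤ.* b) (b ℤ.+ + 1) - potential (a ℤ.+ + 2 ℤ.* b) (+ 0)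
        ∎
      where
      c₁ c₂ c₃ c₄ e₁ e₂ e₄ : ℚ
      c₁ = evalₘ q t (qₘ ^ₘ a) * evalₘ q t ((+ 2 , + 0) ^ₘ b)
      c₂ = evalₘ q t (qₘ ^ₘ a) * evalₘ q t (tₘ ^ₘ b)
      c₃ = evalₘ q t (tₘ ^ₘ a) * evalₘ q t (qₘ ^ₘ b)
      c₄ = evalₘ q t (tₘ ^ₘ a) * evalₘ q t ((+ 0 , + 2) ^ₘ b)
      e₁ = evalₘ q t (+ 3 , + 0)
      e₂ = evalₘ q t (+ 1 , + 1)
      e₄ = evalₘ q t (+ 0 , + 3)
      start : a ℤ.* + 1 ℤ.+ b ℤ.* + 2 ℤ.+ + 3 ≡ a ℤ.+ + 2 ℤ.* b ℤ.- + 2 ℤ.* + 0 ℤ.+ + 3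
      start = ℤ-Solver.solve (a ∷ b ∷ [])
      origin : a ℤ.* + 0 ℤ.+ b ℤ.* + 0 ℤ.+ + 0 ≡ + 0
      origin = ℤ-Solver.solve (a ∷ b ∷ [])
      end : a ℤ.* + 1 ℤ.+ b ℤ.* + 0 ℤ.+ + 1 ≡ a ℤ.+ + 2 ℤ.* b ℤ.- + 2 ℤ.* (b ℤ.+ + 1) ℤ.+ + 3
      end = ℤ-Solver.solve (a ∷ b ∷ [])
      b+1 : a ℤ.* + 0 ℤ.+ b ℤ.* + 1 ℤ.+ + 1 ≡ b ℤ.+ + 1
      b+1 = ℤ-Solver.solve (a ∷ b ∷ [])
      distribute : ∀ c₁ c₂ c₃ c₄ w₁ w₂ w₃ w₄ d →
        (c₁ * w₁ + (c₂ * w₂ + (c₃ * w₃ + (c₄ * w₄ + 0ℚ)))) * d ≡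
        c₁ * (w₁ * d) + (c₂ * (w₂ * d) + (c₃ * (w₃ * d) + c₄ * (w₄ * d)))
      distribute = solve-∀ ℚ-ring
      regroup : ∀ q t c₁ c₂ c₃ c₄ e₁ e₂ e₄ →
        c₁ * (- (q - t * t) * e₁) + (c₂ * ((q - t * t) * e₂) + (c₃ * (- (t - q * q) * e₂) + c₄ * ((t - q * q) * e₄))) ≡
        ((q - t * t) * (c₂ * e₂) - (t - q * q) * (c₃ * e₂)) - ((q - t * t) * (c₁ * e₁) - (t - q * q) * (c₄ * e₄))
      regroup = solve-∀ ℚ-ring

open import Data.Integer using (_+_; _-_; _*_; _≤_)

lemma2p23 : (a b : ℤ) → -[1+ 0 ] ≤ b → b - + 1 ≤ a →
    (q t : ℚ) → Generic q t →
    F3 q t a b ≡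
      sumFromTo (+ 0) b (λ i →
        sumFromTo i (a + + 2 * b - + 2 * i) (λ j →
          evalₘ q t (j , (a + + 2 * b - i) - j)))
lemma2p23 a b -1≤b b-1≤a q t gen@(q≢0 , t≢0 , _) = *-cancelʳ-≢0 (wtDenominator-≢0 gen) (begin
  F3 q t a b ℚ.* wtDenominator q t
    ≡⟨ F3-cleared q≢0 t≢0 a b gen ⟩
  potential q≢0 t≢0 (a + + 2 * b) (b + + 1) ℚ.- potential q≢0 t≢0 (a + + 2 * b) (+ 0)
    ≡⟨ sum-cleared q≢0 t≢0 a b -1≤b b-1≤a ⟨
  wtDenominator q t ℚ.* sumFromTo (+ 0) b (innerSum q≢0 t≢0 (a + + 2 * b))
    ≡⟨ ℚ.*-comm (wtDenominator q t) _ ⟩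
  sumFromTo (+ 0) b (innerSum q≢0 t≢0 (a + + 2 * b)) ℚ.* wtDenominator q t
    ∎)
  where open ≡-Reasoning
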